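{- Let $c$ be a coloring of the vertices of a cycle $C$. Then $c$ is walk-nonrepetitive if and only if $c$ is both a distance-$2$ coloring and a path-nonrepetitive coloring.
   Context: A coloring of a graph $G$ is a function $c\colon V(G)\to\{1,\dots,k\}$ for some positive integer $k$. A walk in $G$ is a sequence $v_1\cdots v_r$ of vertices with $v_iv_{i+1}\in E(G)$ for all $i$; a path is a walk with pairwise distinct vertices. A sequence $a_1\cdots a_{2t}$ is repetitive if $a_i=a_{i+t}$ for all $i\in\{1,\dots,t\}$. A walk $v_1\cdots v_{2t}$ is repetitive (with respect to $c$) if $c(v_1)\cdots c(v_{2t})$ is repetitive, and boring if $v_i=v_{i+t}$ for all $i\in\{1,\dots,t\}$. The coloring $c$ is walk-nonrepetitive if every repetitive walk is boring; it is path-nonrepetitive if no path of $G$ (with an even number of vertices) is repetitive; it is a distance-$2$ coloring if $c(u)\neq c(v)$ for all distinct $u,v$ at distance at most $2$ (i.e. adjacent or having a common neighbor). -}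

module Defs where

open import Data.Nat using (ℕ; suc; _+_; _%_)
open import Data.Fin using (Fin; toℕ)
open import Data.List using (List; []; _∷_; _++_; map)
open import Data.List.Relation.Unary.Linked using (Linked)
open import Data.List.Relation.Unary.Unique.Propositional using (Unique)
open import Data.Product using (∃; ∃-syntax; _×_)
open import Data.Sum using (_⊎_)
open import Relation.Nullary using (¬_)
open import Relation.Binary.PropositionalEquality using (_≡_; _≢_)

CycleAdj : (m : ℕ) → Fin (3 + m) → Fin (3 + m) → Set
CycleAdj m i j = (toℕ j ≡ suc (toℕ i) % (3 + m)) ⊎ (toℕ i ≡ suc (toℕ j) % (3 + m))

module _ {V : Set} (Adj : V → V → Set) where

  IsWalk : List V → Set
  IsWalk = Linked Adj

  IsPath : List V → Set
  IsPath w = IsWalk w × Unique w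

  Distance2 : {K : Set} → (V → K) → Set
  Distance2 c = ∀ u v → u ≢ v → (Adj u v ⊎ ∃[ w ] (Adj u w × Adj w v)) → c u ≢ c v

Repetitive : {A : Set} → List A → Set
Repetitive {A} xs = ∃[ y ] ∃[ ys ] (xs ≡ (y ∷ ys) ++ (y ∷ ys))

module _ {V : Set} (Adj : V → V → Set) {K : Set} (c : V → K) where

  RepetitiveWalk : List V → Set
  RepetitiveWalk w = Repetitive (map c w)

  -- boring walk v₁⋯v_{2t}: v_i = v_{i+t}
  Boring : List V → Set
  Boring w = Repetitive w

  WalkNonrepetitive : Set
  WalkNonrepetitive = ∀ w → IsWalk Adj w → RepetitiveWalk w → Boring w

  PathNonrepetitive : Set
  PathNonrepetitive = ∀ w → IsPath Adj w → ¬ RepetitiveWalk w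

-- A walk-nonrepetitive colouring is distance-2 (the walks u v and u w v w would be
-- repetitive without being boring) and path-nonrepetitive (a boring path repeats a vertex).
-- Conversely, let c be distance-2 and path-nonrepetitive, and let A B be a walk whose two
-- halves carry the same colours. In a distance-2 colouring a walk is determined by its first
-- vertex and its colours, so it suffices that A and B start at the same vertex. Lift the
-- walk to the integers, the universal cover of the cycle, and let C be the induced
-- n-periodic colouring. Colours also detect backtracking, so the lifted halves differ by a
-- motion of ℤ: B = A + δ or B = δ − A. For a translation, C x = C (x + δ) on the interval
-- swept by A, a square of length ∣δ∣; reducing modulo n, and replacing a length above n/2
-- by its complement, yields a square of length at most n/2, that is a repetitive path,
-- unless n ∣ δ. For a reflection, the interval between the starting points is
-- mirror-symmetric in colours, which puts equal colours at distance 1 or 2 in its middle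
-- unless the interval is a single point.
module Submission where

open import Defs

open import Data.Empty using (⊥-elim)
open import Data.Fin using (Fin; toℕ; fromℕ<)
open import Data.Fin.Properties as Finₚ using (toℕ-fromℕ<; toℕ-injective; toℕ<n)
open import Data.List using (List; []; _∷_; _++_; map; applyUpTo)
open import Data.List.Properties using (∷-injectiveˡ; ∷-injectiveʳ; map-∘; map-applyUpTo; ++-conicalʳ)
open import Data.List.Membership.Propositional using (_∈_)
open import Data.List.Relation.Unary.Any using (here; there)
open import Data.List.Relation.Unary.All using (_∷_)
import Data.List.Relation.Unary.All.Properties as Allₚ
open import Data.List.Relation.Unary.AllPairs using (_∷_)
open import Data.List.Relation.Unary.Linked as Linked using (Linked; []; [-]; _∷_)
import Data.List.Relation.Unary.Linked.Properties as Linkedₚ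
open import Data.List.Relation.Unary.Unique.Propositional using (Unique)
import Data.List.Relation.Unary.Unique.Propositional.Properties as Uniqueₚ
open import Data.List.Relation.Binary.Pointwise as Pointwise using (Pointwise; []; _∷_; ≡⇒Pointwise-≡)
open import Data.Nat as ℕ using (ℕ; zero; suc; NonZero; z≤n; s≤s)
import Data.Nat.Properties as ℕₚ
open import Data.Nat.DivMod using (_%_; _/_; m≡m%n+[m/n]*n; m%n<n; m%n≤m; m<n⇒m%n≡m)
open import Data.Nat.Divisibility as ℕ∣ using (∣⇒≤; m%n≡0⇒n∣m)
open import Data.Product as Product using (∃-syntax; ∃₂; _×_; _,_; proj₁; proj₂)
open import Data.Sum as Sum using (_⊎_; inj₁; inj₂)
open import Function using (_∘_)
open import Function.Bundles using (_⇔_; mk⇔)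
open import Relation.Binary.Definitions using (Symmetric; DecidableEquality)
open import Relation.Binary.PropositionalEquality
open import Relation.Nullary using (¬_; yes; no)

open ≡-Reasoning

module _ {A : Set} where

  applyUpTo-++ : ∀ (f : ℕ → A) m k →
                 applyUpTo f (m ℕ.+ k) ≡ applyUpTo f m ++ applyUpTo (λ i → f (m ℕ.+ i)) k
  applyUpTo-++ f zero    k = refl
  applyUpTo-++ f (suc m) k = cong (f 0 ∷_) (applyUpTo-++ (f ∘ suc) m k)

  applyUpTo-cong : ∀ {f g : ℕ → A} k → (∀ {i} → i ℕ.< k → f i ≡ g i) → applyUpTo f k ≡ applyUpTo g k
  applyUpTo-cong zero    _   = refl
  applyUpTo-cong (suc k) f≡g = cong₂ _∷_ (f≡g (s≤s z≤n)) (applyUpTo-cong k (f≡g ∘ s≤s))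

  map-++⁻ : ∀ {B : Set} (f : A → B) zs {xs ys} → map f zs ≡ xs ++ ys →
            ∃₂ λ as bs → zs ≡ as ++ bs × map f as ≡ xs × map f bs ≡ ys
  map-++⁻ f zs       {[]}     eq = [] , zs , refl , refl , eq
  map-++⁻ f []       {_ ∷ _} ()
  map-++⁻ f (z ∷ zs) {_ ∷ xs} {ys} eq with map-++⁻ f zs {xs} {ys} (∷-injectiveʳ eq)
  ... | as , bs , refl , refl , refl = z ∷ as , bs , refl , cong (_∷ _) (∷-injectiveˡ eq) , refl

  Linked-++⁻ : ∀ {R : A → A → Set} xs {ys} → Linked R (xs ++ ys) → Linked R xs × Linked R ys
  Linked-++⁻ []           l       = [] , l
  Linked-++⁻ (_ ∷ [])     l       = [-] , Linked.tail l
  Linked-++⁻ (_ ∷ x ∷ xs) (r ∷ l) = Product.map₁ (r ∷_) (Linked-++⁻ (x ∷ xs) l)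

  pointwise-∈ : ∀ {B : Set} {R : A → B → Set} {g : A → B} {x xs} →
                Pointwise R xs (map g xs) → x ∈ xs → R x (g x)
  pointwise-∈ (r ∷ _)  (here refl)  = r
  pointwise-∈ (_ ∷ rs) (there x∈xs) = pointwise-∈ rs x∈xs

  repetitive-pair : ∀ {u v : A} → Repetitive (u ∷ v ∷ []) → u ≡ v
  repetitive-pair (_ , []     , refl) = refl
  repetitive-pair (_ , _ ∷ ys , eq) with ++-conicalʳ ys _ (sym (∷-injectiveʳ (∷-injectiveʳ eq)))
  ... | ()

  repetitive-quadruple : ∀ {u w v w′ : A} → Repetitive (u ∷ w ∷ v ∷ w′ ∷ []) → u ≡ v
  repetitive-quadruple (_ , []         , ())
  repetitive-quadruple (_ , _ ∷ []     , refl) = refl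
  repetitive-quadruple (_ , _ ∷ _ ∷ []     , ())
  repetitive-quadruple (_ , _ ∷ _ ∷ _ ∷ ys , eq)
    with ++-conicalʳ ys _ (sym (∷-injectiveʳ (∷-injectiveʳ (∷-injectiveʳ (∷-injectiveʳ eq)))))
  ... | ()

  repetitive⇒¬unique : ∀ {xs : List A} → Repetitive xs → ¬ Unique xs
  repetitive⇒¬unique (y , ys , refl) (y∉rest ∷ _) with Allₚ.++⁻ʳ ys y∉rest
  ... | y≢y ∷ _ = y≢y refl

-- Colourings of an arbitrary graph

module _ {V K : Set} {Adj : V → V → Set} {c : V → K} where

  walkNonrepetitive⇒pathNonrepetitive : WalkNonrepetitive Adj c → PathNonrepetitive Adj c
  walkNonrepetitive⇒pathNonrepetitive wn w (walk , unique) rep = repetitive⇒¬unique (wn w walk rep) unique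

  module _ (adj-sym : Symmetric Adj) where

    walkNonrepetitive⇒distance2 : WalkNonrepetitive Adj c → Distance2 Adj c
    walkNonrepetitive⇒distance2 wn u v u≢v (inj₁ uv) cu≡cv =
      u≢v (repetitive-pair (wn (u ∷ v ∷ []) (uv ∷ [-]) (c u , [] , cong (λ k → c u ∷ k ∷ []) (sym cu≡cv))))
    walkNonrepetitive⇒distance2 wn u v u≢v (inj₂ (w , uw , wv)) cu≡cv =
      u≢v (repetitive-quadruple (wn (u ∷ w ∷ v ∷ w ∷ []) (uw ∷ wv ∷ adj-sym wv ∷ [-])
        (c u , c w ∷ [] , cong (λ k → c u ∷ c w ∷ k ∷ c w ∷ []) (sym cu≡cv))))

    colours-determine-walk : DecidableEquality V → Distance2 Adj c → ∀ {x as bs} →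
                             IsWalk Adj (x ∷ as) → IsWalk Adj (x ∷ bs) → map c as ≡ map c bs → as ≡ bs
    colours-determine-walk _≟_ d2 {as = []}    {[]}    _ _ _ = refl
    colours-determine-walk _≟_ d2 {as = []}    {_ ∷ _} _ _ ()
    colours-determine-walk _≟_ d2 {as = _ ∷ _} {[]}    _ _ ()
    colours-determine-walk _≟_ d2 {as = a ∷ _} {b ∷ _} (xa ∷ wa) (xb ∷ wb) eq with a ≟ b
    ... | yes refl = cong (a ∷_) (colours-determine-walk _≟_ d2 wa wb (∷-injectiveʳ eq))
    ... | no a≢b   = ⊥-elim (d2 a b a≢b (inj₂ (_ , adj-sym xa , xb)) (∷-injectiveˡ eq))

-- The integers are opened only inside this module, so that _+_ in lemma4 below is ℕ's.
module _ where

  open import Data.Integer as ℤ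
    using (ℤ; +_; -[1+_]; _+_; _-_; -_; _*_; 0ℤ; 1ℤ; -1ℤ; _≤_; ∣_∣; _%ℕ_; _/ℕ_)
  import Data.Integer.Properties as ℤₚ
  open import Data.Integer.DivMod using (n%ℕd<d; a≡a%ℕn+[a/ℕn]*n)
  open import Data.Integer.Divisibility.Signed
    using (_∣_; divides; ∣⇒∣ᵤ; ∣ᵤ⇒∣; ∣-refl; ∣m+n∣n⇒∣m; ∣n⇒∣m*n; ∣m⇒∣-m)
  open import Data.Integer.Tactic.RingSolver using (solve; solve-∀)

  -- The covering map ℤ → ℤ/n

  module Cover (n : ℕ) .{{_ : NonZero n}} where

    π : ℤ → Fin n
    π p = fromℕ< (n%ℕd<d p n)

    π-toℕ : ∀ x → π (+ toℕ x) ≡ x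
    π-toℕ x = toℕ-injective (trans (toℕ-fromℕ< _) (m<n⇒m%n≡m (toℕ<n x)))

    multiple<n⇒≡0 : ∀ {x} → n ℕ∣.∣ x → x ℕ.< n → x ≡ 0
    multiple<n⇒≡0 {zero}  _   _   = refl
    multiple<n⇒≡0 {suc x} n∣x x<n = ⊥-elim (ℕₚ.<⇒≱ x<n (∣⇒≤ n∣x))

    remainder-unique : ∀ {a b} → a ℕ.< n → b ℕ.< n → + n ∣ + b - + a → b ≡ a
    remainder-unique {a} {b} a<n b<n n∣b-a =
      ℤₚ.+-injective (ℤₚ.i-j≡0⇒i≡j (+ b) (+ a) (ℤₚ.∣i∣≡0⇒i≡0 (multiple<n⇒≡0 (∣⇒∣ᵤ n∣b-a) ∣b-a∣<n)))
      where
      ∣b-a∣<n : ∣ + b - + a ∣ ℕ.< n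
      ∣b-a∣<n = subst (ℕ._< n) (cong ∣_∣ (sym (ℤₚ.m-n≡m⊖n b a)))
                  (ℕₚ.≤-<-trans (ℤₚ.∣m⊝n∣≤m⊔n b a) (ℕₚ.⊔-lub b<n a<n))

    π-≡⇒∣ : ∀ {p q} → π p ≡ π q → + n ∣ q - p
    π-≡⇒∣ {p} {q} πp≡πq = divides (Q - P) (begin
      q - p                                  ≡⟨ cong₂ _-_ (a≡a%ℕn+[a/ℕn]*n q n) (a≡a%ℕn+[a/ℕn]*n p n) ⟩
      (+ (q %ℕ n) + Q * + n) - (r + P * + n) ≡⟨ cong (λ s → (+ s + Q * + n) - (r + P * + n)) same-remainder ⟩
      (r + Q * + n) - (r + P * + n)          ≡⟨ cancel r Q P (+ n) ⟩
      (Q - P) * + n                          ∎)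
      where
      r P Q : ℤ
      r = + (p %ℕ n)
      P = p /ℕ n
      Q = q /ℕ n
      same-remainder : q %ℕ n ≡ p %ℕ n
      same-remainder = trans (sym (toℕ-fromℕ< _)) (trans (cong toℕ (sym πp≡πq)) (toℕ-fromℕ< _))
      cancel : ∀ r Q P N → (r + Q * N) - (r + P * N) ≡ (Q - P) * N
      cancel = solve-∀

    ∣⇒π-≡ : ∀ {p q} → + n ∣ q - p → π p ≡ π q
    ∣⇒π-≡ {p} {q} n∣q-p = toℕ-injective (begin
      toℕ (π p) ≡⟨ toℕ-fromℕ< _ ⟩
      p %ℕ n    ≡⟨ remainder-unique (n%ℕd<d p n) (n%ℕd<d q n) n∣Δ ⟨
      q %ℕ n    ≡⟨ toℕ-fromℕ< _ ⟨
      toℕ (π q) ∎)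
      where
      Δ : ℤ
      Δ = + (q %ℕ n) - + (p %ℕ n)
      regroup : ∀ r s Q P N → (r + Q * N) - (s + P * N) ≡ (r - s) + (Q - P) * N
      regroup = solve-∀
      decompose : q - p ≡ Δ + (q /ℕ n - p /ℕ n) * + n
      decompose = trans (cong₂ _-_ (a≡a%ℕn+[a/ℕn]*n q n) (a≡a%ℕn+[a/ℕn]*n p n))
                        (regroup (+ (q %ℕ n)) (+ (p %ℕ n)) (q /ℕ n) (p /ℕ n) (+ n))
      n∣Δ : + n ∣ Δ
      n∣Δ = ∣m+n∣n⇒∣m (subst (+ n ∣_) decompose n∣q-p) (∣n⇒∣m*n (q /ℕ n - p /ℕ n) ∣-refl)

    π-+-cong : ∀ {p q} r → π p ≡ π q → π (p + r) ≡ π (q + r)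
    π-+-cong {p} {q} r πp≡πq = ∣⇒π-≡ {p + r} {q + r} (subst (+ n ∣_) (shift q p r) (π-≡⇒∣ {p} {q} πp≡πq))
      where
      shift : ∀ q p r → q - p ≡ (q + r) - (p + r)
      shift = solve-∀

    π-injective-window : ∀ {p q i j} → i ℕ.< n → j ℕ.< n → q - p ≡ + j - + i → π p ≡ π q → j ≡ i
    π-injective-window {p} {q} i<n j<n q-p≡j-i πp≡πq =
      remainder-unique i<n j<n (subst (+ n ∣_) q-p≡j-i (π-≡⇒∣ {p} {q} πp≡πq))

  -- Walks on the integers

  Step : ℤ → ℤ → Set
  Step p q = q ≡ p + 1ℤ ⊎ q ≡ p - 1ℤ

  up-down : ∀ p → (p + 1ℤ) - 1ℤ ≡ p
  up-down = solve-∀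

  down-up : ∀ p → (p - 1ℤ) + 1ℤ ≡ p
  down-up = solve-∀

  up-up : ∀ p → (p + 1ℤ) + 1ℤ ≡ p + + 2
  up-up = solve-∀

  straight : ∀ {p u q} → Step p u → Step u q → q ≢ p → q ≡ (u + u) - p
  straight {p} (inj₁ refl) (inj₁ refl) _   = up-up′ p
    where
    up-up′ : ∀ p → (p + 1ℤ) + 1ℤ ≡ ((p + 1ℤ) + (p + 1ℤ)) - p
    up-up′ = solve-∀
  straight {p} (inj₁ refl) (inj₂ refl) q≢p = ⊥-elim (q≢p (up-down p))
  straight {p} (inj₂ refl) (inj₁ refl) q≢p = ⊥-elim (q≢p (down-up p))
  straight {p} (inj₂ refl) (inj₂ refl) _   = down-down p
    where
    down-down : ∀ p → (p - 1ℤ) - 1ℤ ≡ ((p - 1ℤ) + (p - 1ℤ)) - p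
    down-down = solve-∀

  Between : ℤ → ℤ → ℤ → Set
  Between a b x = (a ≤ x × x ≤ b) ⊎ (b ≤ x × x ≤ a)

  Between-sym : ∀ {a b x} → Between a b x → Between b a x
  Between-sym = Sum.swap

  Between-+ : ∀ lo {i D} → i ℕ.≤ D → Between lo (lo + + D) (lo + + i)
  Between-+ lo i≤D = inj₁ (ℤₚ.i≤i+j lo (+ _) , ℤₚ.+-monoʳ-≤ lo (ℤ.+≤+ i≤D))

  Between-self : ∀ {b x} → Between b b x → x ≡ b
  Between-self (inj₁ (b≤x , x≤b)) = ℤₚ.≤-antisym x≤b b≤x
  Between-self (inj₂ (b≤x , x≤b)) = ℤₚ.≤-antisym x≤b b≤x

  Between-step : ∀ {a a′ b x} → Step a a′ → x ≢ a → Between a b x → Between a′ b x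
  Between-step {a} (inj₁ refl) x≢a (inj₁ (a≤x , x≤b)) =
    inj₁ (subst (_≤ _) (ℤₚ.+-comm 1ℤ a) (ℤₚ.i<j⇒suc[i]≤j (ℤₚ.≤∧≢⇒< a≤x (x≢a ∘ sym))) , x≤b)
  Between-step {a} (inj₁ refl) _   (inj₂ (b≤x , x≤a)) = inj₂ (b≤x , ℤₚ.≤-trans x≤a (ℤₚ.i≤i+j a 1ℤ))
  Between-step {a} (inj₂ refl) _   (inj₁ (a≤x , x≤b)) = inj₁ (ℤₚ.≤-trans (ℤₚ.i-j≤i a 1ℤ) a≤x , x≤b)
  Between-step {a} (inj₂ refl) x≢a (inj₂ (b≤x , x≤a)) =
    inj₂ (b≤x , subst (_ ≤_) (ℤₚ.+-comm -1ℤ a) (ℤₚ.i<j⇒i≤pred[j] (ℤₚ.≤∧≢⇒< x≤a x≢a)))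

  visits : ∀ {a as b bs x} → Linked Step (a ∷ as ++ b ∷ bs) → Between a b x → x ≢ b → x ∈ a ∷ as
  visits {a} {x = x} walk btw x≢b with x ℤ.≟ a
  ... | yes x≡a = here x≡a
  visits {as = []}    (step ∷ _)    btw x≢b | no x≢a = ⊥-elim (x≢b (Between-self (Between-step step x≢a btw)))
  visits {as = _ ∷ _} (step ∷ walk) btw x≢b | no x≢a = there (visits walk (Between-step step x≢a btw) x≢b)

  a+[b-a]≡b : ∀ a b → a + (b - a) ≡ b
  a+[b-a]≡b = solve-∀

  [a+d]-a≡d : ∀ a d → (a + d) - a ≡ d
  [a+d]-a≡d = solve-∀

  +-cancelˡ : ∀ a {x y} → a + x ≡ a + y → x ≡ y
  +-cancelˡ a {x} {y} a+x≡a+y = begin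
    x           ≡⟨ [a+d]-a≡d a x ⟨
    (a + x) - a ≡⟨ cong (_- a) a+x≡a+y ⟩
    (a + y) - a ≡⟨ [a+d]-a≡d a y ⟩
    y           ∎

  orientation : ∀ a b → ∃[ D ] (b ≡ a + + D ⊎ a ≡ b + + D)
  orientation a b with b - a in b-a≡
  ... | + D      = D , inj₁ (trans (sym (a+[b-a]≡b a b)) (cong (λ d → a + d) b-a≡))
  ... | -[1+ D ] = suc D , inj₂ (trans (sym (b-[b-a]≡a a b)) (cong (λ d → b - d) b-a≡))
    where
    b-[b-a]≡a : ∀ a b → b - (b - a) ≡ a
    b-[b-a]≡a = solve-∀

  data Motion : Set where
    shift mirror : ℤ → Motion

  ⟦_⟧ : Motion → ℤ → ℤ
  ⟦ shift δ ⟧  x = x + δ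
  ⟦ mirror δ ⟧ x = δ - x

  ⟦⟧-straight : ∀ f p u → ⟦ f ⟧ ((u + u) - p) ≡ (⟦ f ⟧ u + ⟦ f ⟧ u) - ⟦ f ⟧ p
  ⟦⟧-straight (shift δ)  p u = shift-straight δ p u
    where
    shift-straight : ∀ δ p u → ((u + u) - p) + δ ≡ ((u + δ) + (u + δ)) - (p + δ)
    shift-straight = solve-∀
  ⟦⟧-straight (mirror δ) p u = mirror-straight δ p u
    where
    mirror-straight : ∀ δ p u → δ - ((u + u) - p) ≡ ((δ - u) + (δ - u)) - (δ - p)
    mirror-straight = solve-∀

  shifted : ∀ a b d → (a + d) + (b - a) ≡ b + d
  shifted = solve-∀

  mirrored : ∀ a b d → (a + b) - (a + d) ≡ b - d
  mirrored = solve-∀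

  motion-through : ∀ {a a′ b b′} → Step a a′ → Step b b′ → ∃[ f ] ⟦ f ⟧ a ≡ b × ⟦ f ⟧ a′ ≡ b′
  motion-through {a} {b = b} (inj₁ refl) (inj₁ refl) = shift (b - a) , a+[b-a]≡b a b , shifted a b 1ℤ
  motion-through {a} {b = b} (inj₁ refl) (inj₂ refl) = mirror (a + b) , [a+d]-a≡d a b , mirrored a b 1ℤ
  motion-through {a} {b = b} (inj₂ refl) (inj₁ refl) = mirror (a + b) , [a+d]-a≡d a b , mirrored a b -1ℤ
  motion-through {a} {b = b} (inj₂ refl) (inj₂ refl) = shift (b - a) , a+[b-a]≡b a b , shifted a b -1ℤ

  -- Periodic colourings of the integers

  Square : {K : Set} → (ℤ → K) → ℤ → ℕ → Set
  Square C j D = ∀ i → i ℕ.< D → C (j + + i) ≡ C (j + + i + + D)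

  module PeriodicColouring {K : Set} (n : ℕ) .{{_ : NonZero n}} (C : ℤ → K)
    (C-periodic        : ∀ {p q} → + n ∣ q - p → C p ≡ C q)
    (C-adjacent        : ∀ p → C p ≢ C (p + 1ℤ))
    (C-distance-2      : ∀ p → C p ≢ C (p + + 2))
    (short-square-free : ∀ j D → 1 ℕ.≤ D → D ℕ.+ D ℕ.≤ n → ¬ Square C j D)
    where

    _≈_ : ℤ → ℤ → Set
    p ≈ q = C p ≡ C q

    backtrack : ∀ {p u q} → Step p u → Step u q → p ≈ q → q ≡ p
    backtrack {p} (inj₁ refl) (inj₁ refl) p≈q = ⊥-elim (C-distance-2 p (trans p≈q (cong C (up-up p))))
    backtrack {p} (inj₁ refl) (inj₂ refl) _ = up-down p
    backtrack {p} (inj₂ refl) (inj₁ refl) _ = down-up p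
    backtrack {p} (inj₂ refl) (inj₂ refl) p≈q =
      ⊥-elim (C-distance-2 ((p - 1ℤ) - 1ℤ) (trans (sym p≈q) (cong C (down-down p))))
      where
      down-down : ∀ p → p ≡ ((p - 1ℤ) - 1ℤ) + + 2
      down-down = solve-∀

    -- Equal colours two steps apart mean backtracking, so both walks turn back at the same
    -- moments and otherwise go straight, which a motion preserves.
    motion-extends-by-step : ∀ f {a a′ a″ b b′ b″} → Step a a′ → Step a′ a″ → Step b b′ → Step b′ b″ →
                  a ≈ b → a″ ≈ b″ → ⟦ f ⟧ a ≡ b → ⟦ f ⟧ a′ ≡ b′ → ⟦ f ⟧ a″ ≡ b″
    motion-extends-by-step f {a} {a′} {a″} {b} {b′} {b″} sa sa′ sb sb′ a≈b a″≈b″ fa fa′ with a″ ℤ.≟ a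
    ... | yes refl = trans fa (sym (backtrack sb sb′ (trans (sym a≈b) a″≈b″)))
    ... | no a″≢a = begin
      ⟦ f ⟧ a″                         ≡⟨ cong ⟦ f ⟧ (straight sa sa′ a″≢a) ⟩
      ⟦ f ⟧ ((a′ + a′) - a)            ≡⟨ ⟦⟧-straight f a a′ ⟩
      (⟦ f ⟧ a′ + ⟦ f ⟧ a′) - ⟦ f ⟧ a  ≡⟨ cong₂ (λ u p → (u + u) - p) fa′ fa ⟩
      (b′ + b′) - b                    ≡⟨ straight sb sb′ b″≢b ⟨
      b″                               ∎
      where
      b″≢b : b″ ≢ b
      b″≢b b″≡b = a″≢a (backtrack sa sa′ (trans a≈b (trans (cong C (sym b″≡b)) (sym a″≈b″))))

    motion-extends : ∀ f {a a′ as b b′ bs} → ⟦ f ⟧ a ≡ b → ⟦ f ⟧ a′ ≡ b′ →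
             Linked Step (a ∷ a′ ∷ as) → Linked Step (b ∷ b′ ∷ bs) → Pointwise _≈_ (a ∷ a′ ∷ as) (b ∷ b′ ∷ bs) →
             b ∷ b′ ∷ bs ≡ map ⟦ f ⟧ (a ∷ a′ ∷ as)
    motion-extends f fa fa′ _ _ (_ ∷ _ ∷ []) = sym (cong₂ _∷_ fa (cong (_∷ []) fa′))
    motion-extends f fa fa′ (sa ∷ wa@(sa′ ∷ _)) (sb ∷ wb@(sb′ ∷ _)) (a≈b ∷ matched@(_ ∷ a″≈b″ ∷ _)) =
      cong₂ _∷_ (sym fa)
        (motion-extends f fa′ (motion-extends-by-step f sa sa′ sb sb′ a≈b a″≈b″ fa fa′) wa wb matched)

    matched⇒motion : ∀ {a as b bs} → Linked Step (a ∷ as) → Linked Step (b ∷ bs) → Pointwise _≈_ (a ∷ as) (b ∷ bs) →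
            ∃[ f ] b ∷ bs ≡ map ⟦ f ⟧ (a ∷ as)
    matched⇒motion {a} {b = b} _ _ (_ ∷ []) = shift (b - a) , cong (_∷ []) (sym (a+[b-a]≡b a b))
    matched⇒motion (sa ∷ wa) (sb ∷ wb) matched@(_ ∷ _ ∷ _) with motion-through sa sb
    ... | f , fa , fa′ = f , motion-extends f fa fa′ (sa ∷ wa) (sb ∷ wb) matched

    square-mod : ∀ {j D} → Square C j D → Square C j (D % n)
    square-mod {j} {D} sq i i<r = trans (sq i (ℕₚ.<-≤-trans i<r (m%n≤m D n))) (sym (C-periodic n∣))
      where
      x : ℤ
      x = j + + i
      cancel : ∀ x r m → (x + (r + m)) - (x + r) ≡ m
      cancel = solve-∀
      +D≡ : + D ≡ + (D % n) + + (D / n) * + n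
      +D≡ = trans (cong +_ (m≡m%n+[m/n]*n D n))
              (trans (ℤₚ.pos-+ (D % n) _) (cong (λ m → + (D % n) + m) (ℤₚ.pos-* (D / n) n)))
      n∣ : + n ∣ (x + + D) - (x + + (D % n))
      n∣ = divides (+ (D / n)) (trans (cong (λ d → (x + d) - (x + + (D % n))) +D≡) (cancel x _ _))

    square-flip : ∀ {j D S} → S ℕ.+ D ≡ n → S ℕ.≤ D → Square C j D → Square C (j + + D) S
    square-flip {j} {D} {S} S+D≡n S≤D sq i i<S = begin
      C (j + + D + + i)        ≡⟨ cong C (swap j (+ D) (+ i)) ⟩
      C (j + + i + + D)        ≡⟨ sq i (ℕₚ.<-≤-trans i<S S≤D) ⟨
      C (j + + i)              ≡⟨ C-periodic n∣ ⟩
      C (j + + D + + i + + S)  ∎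
      where
      swap : ∀ j d i → j + d + i ≡ j + i + d
      swap = solve-∀
      wrap : ∀ j d i s → (j + d + i + s) - (j + i) ≡ s + d
      wrap = solve-∀
      n∣ : + n ∣ (j + + D + + i + + S) - (j + + i)
      n∣ = divides 1ℤ (begin
        (j + + D + + i + + S) - (j + + i) ≡⟨ wrap j (+ D) (+ i) (+ S) ⟩
        + S + + D                         ≡⟨ ℤₚ.pos-+ S D ⟨
        + (S ℕ.+ D)                       ≡⟨ cong +_ S+D≡n ⟩
        + n                               ≡⟨ ℤₚ.*-identityˡ (+ n) ⟨
        1ℤ * + n                          ∎)

    nontrivial-square-absent : ∀ {j r} → r ≢ 0 → r ℕ.< n → ¬ Square C j r
    nontrivial-square-absent {j} {r} r≢0 r<n sq with r ℕ.+ r ℕₚ.≤? n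
    ... | yes 2r≤n = short-square-free j r (ℕₚ.n≢0⇒n>0 r≢0) 2r≤n sq
    ... | no  2r≰n = short-square-free (j + + r) S (ℕₚ.m<n⇒0<n∸m r<n) 2S≤n (square-flip {j} S+r≡n (ℕₚ.<⇒≤ S<r) sq)
      where
      S : ℕ
      S = n ℕ.∸ r
      S+r≡n : S ℕ.+ r ≡ n
      S+r≡n = ℕₚ.m∸n+n≡m (ℕₚ.<⇒≤ r<n)
      S<r : S ℕ.< r
      S<r = ℕₚ.+-cancelʳ-< r S r (subst (ℕ._< r ℕ.+ r) (sym S+r≡n) (ℕₚ.≰⇒> 2r≰n))
      2S≤n : S ℕ.+ S ℕ.≤ n
      2S≤n = subst (S ℕ.+ S ℕ.≤_) S+r≡n (ℕₚ.+-monoʳ-≤ S (ℕₚ.<⇒≤ S<r))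

    square-period : ∀ {j D} → Square C j D → n ℕ∣.∣ D
    square-period {j} {D} sq with D % n ℕ.≟ 0
    ... | yes r≡0 = m%n≡0⇒n∣m D n r≡0
    ... | no  r≢0 = ⊥-elim (nontrivial-square-absent {j} r≢0 (m%n<n D n) (square-mod {j} sq))

    -- Narrowing the window at both ends keeps it symmetric; at width 1 or 2 the symmetry
    -- would give equal colours at distance 1 or 2.
    mirror-trivial : ∀ lo D → (∀ i k → i ℕ.+ k ≡ D → C (lo + + i) ≡ C (lo + + k)) → D ≡ 0
    mirror-trivial lo 0 _ = refl
    mirror-trivial lo 1 symmetric =
      ⊥-elim (C-adjacent lo (trans (cong C (sym (ℤₚ.+-identityʳ lo))) (symmetric 0 1 refl)))
    mirror-trivial lo 2 symmetric =
      ⊥-elim (C-distance-2 lo (trans (cong C (sym (ℤₚ.+-identityʳ lo))) (symmetric 0 2 refl)))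
    mirror-trivial lo (suc (suc (suc D))) symmetric = ⊥-elim (ℕₚ.1+n≢0 (mirror-trivial (lo + 1ℤ) (suc D) inner))
      where
      inward : ∀ i → lo + 1ℤ + + i ≡ lo + + suc i
      inward i = ℤₚ.+-assoc lo 1ℤ (+ i)
      inner : ∀ i k → i ℕ.+ k ≡ suc D → C (lo + 1ℤ + + i) ≡ C (lo + 1ℤ + + k)
      inner i k i+k≡ = begin
        C (lo + 1ℤ + + i) ≡⟨ cong C (inward i) ⟩
        C (lo + + suc i)  ≡⟨ symmetric (suc i) (suc k) (cong suc (trans (ℕₚ.+-suc i k) (cong suc i+k≡))) ⟩
        C (lo + + suc k)  ≡⟨ cong C (inward k) ⟨
        C (lo + 1ℤ + + k) ∎

    mirror-window : ∀ lo D → (∀ x → Between lo (lo + + D) x → C x ≡ C ((lo + (lo + + D)) - x)) → D ≡ 0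
    mirror-window lo D symmetric = mirror-trivial lo D λ i k i+k≡D → begin
      C (lo + + i)                        ≡⟨ symmetric (lo + + i) (Between-+ lo (subst (i ℕ.≤_) i+k≡D (ℕₚ.m≤m+n i k))) ⟩
      C ((lo + (lo + + D)) - (lo + + i))  ≡⟨ cong C (reflect i k i+k≡D) ⟩
      C (lo + + k)                        ∎
      where
      reflect-ring : ∀ lo x y → (lo + (lo + (x + y))) - (lo + x) ≡ lo + y
      reflect-ring = solve-∀
      reflect : ∀ i k → i ℕ.+ k ≡ D → (lo + (lo + + D)) - (lo + + i) ≡ lo + + k
      reflect i k i+k≡D = subst (λ d → (lo + (lo + + d)) - (lo + + i) ≡ lo + + k) i+k≡D
        (trans (cong (λ d → (lo + (lo + d)) - (lo + + i)) (ℤₚ.pos-+ i k)) (reflect-ring lo (+ i) (+ k)))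

    reflection-trivial : ∀ {a b} → (∀ x → Between a b x → C x ≡ C ((a + b) - x)) → a ≡ b
    reflection-trivial {a} {b} symmetric with orientation a b
    ... | D , inj₁ refl = trans (sym (ℤₚ.+-identityʳ a)) (cong (λ d → a + + d) (sym (mirror-window a D symmetric)))
    ... | D , inj₂ refl = trans (cong (λ d → b + + d) (mirror-window b D symmetric′)) (ℤₚ.+-identityʳ b)
      where
      symmetric′ : ∀ x → Between b (b + + D) x → C x ≡ C ((b + (b + + D)) - x)
      symmetric′ x btw = trans (symmetric x (Between-sym btw)) (cong (λ s → C (s - x)) (ℤₚ.+-comm (b + + D) b))

    translation-period : ∀ {a b} → (∀ x → Between a b x → x ≢ b → C x ≡ C (x + (b - a))) → + n ∣ b - a
    translation-period {a} {b} periodic with orientation a b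
    ... | D , inj₁ refl = subst (+ n ∣_) (sym ([a+d]-a≡d a (+ D))) (∣ᵤ⇒∣ (square-period {a} sq))
      where
      sq : Square C a D
      sq i i<D = trans (periodic (a + + i) (Between-+ a (ℕₚ.<⇒≤ i<D)) i≢D)
                       (cong (λ d → C (a + + i + d)) ([a+d]-a≡d a (+ D)))
        where
        i≢D : a + + i ≢ a + + D
        i≢D e = ℕₚ.<-irrefl (ℤₚ.+-injective (+-cancelˡ a e)) i<D
    -- Here the hypothesis covers b + 1, …, b + D, the upper half of the square at j.
    ... | D , inj₂ refl = subst (+ n ∣_) (sym (back b (+ D))) (∣m⇒∣-m (∣ᵤ⇒∣ (square-period {j} sq)))
      where
      back : ∀ b d → b - (b + d) ≡ - d
      back = solve-∀
      j : ℤ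
      j = (b + 1ℤ) - + D
      down-shift : ∀ b d i → ((b + 1ℤ) - d) + i ≡ (b + (1ℤ + i)) + (b - (b + d))
      down-shift = solve-∀
      up-shift : ∀ b d i → b + (1ℤ + i) ≡ ((b + 1ℤ) - d) + i + d
      up-shift = solve-∀
      sq : Square C j D
      sq i i<D = begin
        C (j + + i)                          ≡⟨ cong C (down-shift b (+ D) (+ i)) ⟩
        C (b + + suc i + (b - (b + + D)))    ≡⟨ periodic (b + + suc i) btw x≢b ⟨
        C (b + + suc i)                      ≡⟨ cong C (up-shift b (+ D) (+ i)) ⟩
        C (j + + i + + D)                    ∎
        where
        btw : Between (b + + D) b (b + + suc i)
        btw = inj₂ (ℤₚ.i≤i+j b (+ suc i) , ℤₚ.+-monoʳ-≤ b (ℤ.+≤+ i<D))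
        x≢b : b + + suc i ≢ b
        x≢b e with +-cancelˡ b (trans e (sym (ℤₚ.+-identityʳ b)))
        ... | ()

    shifted-halves-congruent : ∀ {δ a as b bs} → Linked Step (a ∷ as ++ b ∷ bs) →
                   Pointwise _≈_ (a ∷ as) (map ⟦ shift δ ⟧ (a ∷ as)) → b ≡ a + δ → + n ∣ b - a
    shifted-halves-congruent {δ} {a} walk matched refl = translation-period λ x btw x≢b →
      trans (pointwise-∈ matched (visits walk btw x≢b)) (cong (λ d → C (x + d)) (sym ([a+d]-a≡d a δ)))

    mirrored-halves-coincide : ∀ {δ a as b bs} → Linked Step (a ∷ as ++ b ∷ bs) →
                    Pointwise _≈_ (a ∷ as) (map ⟦ mirror δ ⟧ (a ∷ as)) → b ≡ δ - a → a ≡ b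
    mirrored-halves-coincide {δ} {a} walk matched@(a≈b ∷ _) refl = reflection-trivial symmetric
      where
      symmetric : ∀ x → Between a (δ - a) x → C x ≡ C ((a + (δ - a)) - x)
      symmetric x btw with x ℤ.≟ δ - a
      ... | yes refl = trans (sym a≈b) (cong C (sym (cancel a (δ - a))))
        where
        cancel : ∀ a d → (a + d) - d ≡ a
        cancel = solve-∀
      ... | no x≢b = trans (pointwise-∈ matched (visits walk btw x≢b)) (cong (λ d → C (d - x)) (sym (a+[b-a]≡b a δ)))

    halves-congruent : ∀ {a as b bs} → Linked Step (a ∷ as ++ b ∷ bs) → Pointwise _≈_ (a ∷ as) (b ∷ bs) → + n ∣ b - a
    halves-congruent {a} {as} walk matched with Linked-++⁻ (a ∷ as) walk
    ... | walkA , walkB with matched⇒motion walkA walkB matched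
    ... | shift δ  , image =
      shifted-halves-congruent {δ} walk (subst (Pointwise _≈_ (a ∷ as)) image matched) (∷-injectiveˡ image)
    ... | mirror δ , image =
      subst (λ b → + n ∣ b - a)
            (mirrored-halves-coincide {δ} walk (subst (Pointwise _≈_ (a ∷ as)) image matched) (∷-injectiveˡ image))
            (divides 0ℤ (ℤₚ.+-inverseʳ a))

  -- The cycle on 3 + m vertices

  module Cycle (m : ℕ) where

    n : ℕ
    n = 3 ℕ.+ m

    open Cover n

    CycleAdj-sym : Symmetric (CycleAdj m)
    CycleAdj-sym = Sum.swap

    toℕ-π-+1 : ∀ p → toℕ (π (p + 1ℤ)) ≡ suc (toℕ (π p)) % n
    toℕ-π-+1 p = begin
      toℕ (π (p + 1ℤ))            ≡⟨ cong toℕ (π-+-cong {p} {+ toℕ (π p)} 1ℤ (sym (π-toℕ (π p)))) ⟩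
      toℕ (π (+ toℕ (π p) + 1ℤ))  ≡⟨ cong (toℕ ∘ π) (ℤₚ.+-comm (+ toℕ (π p)) 1ℤ) ⟩
      toℕ (π (+ suc (toℕ (π p)))) ≡⟨ toℕ-fromℕ< _ ⟩
      suc (toℕ (π p)) % n         ∎

    Step⇒CycleAdj : ∀ {p q} → Step p q → CycleAdj m (π p) (π q)
    Step⇒CycleAdj {p} (inj₁ refl) = inj₁ (toℕ-π-+1 p)
    Step⇒CycleAdj {p} (inj₂ refl) = inj₂ (trans (cong (toℕ ∘ π) (sym (down-up p))) (toℕ-π-+1 (p - 1ℤ)))

    CycleAdj-lift : ∀ p {v} → CycleAdj m (π p) v → ∃[ q ] Step p q × π q ≡ v
    CycleAdj-lift p     (inj₁ v≡) = p + 1ℤ , inj₁ refl , toℕ-injective (trans (toℕ-π-+1 p) (sym v≡))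
    CycleAdj-lift p {v} (inj₂ p≡) = p - 1ℤ , inj₂ refl , (begin
      π (p - 1ℤ)              ≡⟨ π-+-cong {p} {+ suc (toℕ v)} -1ℤ (toℕ-injective (trans p≡ (sym (toℕ-fromℕ< _)))) ⟩
      π (+ suc (toℕ v) - 1ℤ)  ≡⟨⟩
      π (+ toℕ v)             ≡⟨ π-toℕ v ⟩
      v                       ∎)

    lift-walk : ∀ {p v vs} → π p ≡ v → IsWalk (CycleAdj m) (v ∷ vs) →
                ∃[ ps ] Linked Step (p ∷ ps) × map π (p ∷ ps) ≡ v ∷ vs
    lift-walk {vs = []} πp≡v _ = [] , [-] , cong (_∷ []) πp≡v
    lift-walk {p} {vs = _ ∷ _} refl (adj ∷ walk) with CycleAdj-lift p adj
    ... | q , step , πq≡ with lift-walk πq≡ walk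
    ... | qs , steps , πqs = q ∷ qs , step ∷ steps , cong (π p ∷_) πqs

    module _ {K : Set} (c : Fin n → K) (d2 : Distance2 (CycleAdj m) c) (pn : PathNonrepetitive (CycleAdj m) c) where

      C : ℤ → K
      C = c ∘ π

      C-adjacent : ∀ p → C p ≢ C (p + 1ℤ)
      C-adjacent p = d2 (π p) (π (p + 1ℤ))
        (λ e → ℕₚ.1+n≢0 (π-injective-window {p} {p + 1ℤ} (s≤s z≤n) (s≤s (s≤s z≤n)) ([a+d]-a≡d p 1ℤ) e))
        (inj₁ (Step⇒CycleAdj {p} (inj₁ refl)))

      C-distance-2 : ∀ p → C p ≢ C (p + + 2)
      C-distance-2 p = d2 (π p) (π (p + + 2))
        (λ e → ℕₚ.1+n≢0 (π-injective-window {p} {p + + 2} (s≤s z≤n) (s≤s (s≤s (s≤s z≤n))) ([a+d]-a≡d p (+ 2)) e))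
        (inj₂ (π (p + 1ℤ) , Step⇒CycleAdj {p} (inj₁ refl) ,
          subst (CycleAdj m (π (p + 1ℤ)) ∘ π) (up-up p) (Step⇒CycleAdj {p + 1ℤ} (inj₁ refl))))

      short-square-free : ∀ j D → 1 ℕ.≤ D → D ℕ.+ D ℕ.≤ n → ¬ Square C j D
      short-square-free j (suc D) _ 2D≤n sq =
        pn path (walk , unique) (C (j + + 0) , applyUpTo (λ i → C (j + + suc i)) D , colours)
        where
        vertex : ℕ → Fin n
        vertex i = π (j + + i)
        path : List (Fin n)
        path = applyUpTo vertex (suc D ℕ.+ suc D)
        half : List K
        half = applyUpTo (λ i → C (j + + i)) (suc D)
        succ : ∀ j x → j + (1ℤ + x) ≡ j + x + 1ℤ
        succ = solve-∀
        walk : IsWalk (CycleAdj m) path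
        walk = Linkedₚ.applyUpTo⁺₂ vertex _ (λ i → Step⇒CycleAdj {j + + i} (inj₁ (succ j (+ i))))
        diff : ∀ j x y → (j + y) - (j + x) ≡ y - x
        diff = solve-∀
        unique : Unique path
        unique = Uniqueₚ.applyUpTo⁺₁ vertex _ λ {i} {i′} i<i′ i′<2D e →
          ℕₚ.<-irrefl (sym (π-injective-window {j + + i} {j + + i′} (ℕₚ.<-trans i<i′ (ℕₚ.<-≤-trans i′<2D 2D≤n))
            (ℕₚ.<-≤-trans i′<2D 2D≤n) (diff j (+ i) (+ i′)) e)) i<i′
        regroup : ∀ j x y → j + (x + y) ≡ j + y + x
        regroup = solve-∀
        colours : map c path ≡ half ++ half
        colours = begin
          map c path                                                ≡⟨ map-applyUpTo vertex c _ ⟩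
          applyUpTo (λ i → C (j + + i)) (suc D ℕ.+ suc D)           ≡⟨ applyUpTo-++ (λ i → C (j + + i)) (suc D) (suc D) ⟩
          half ++ applyUpTo (λ i → C (j + + (suc D ℕ.+ i))) (suc D) ≡⟨ cong (half ++_) (applyUpTo-cong (suc D) second-half) ⟩
          half ++ half                                              ∎
          where
          second-half : ∀ {i} → i ℕ.< suc D → C (j + + (suc D ℕ.+ i)) ≡ C (j + + i)
          second-half {i} i<D = begin
            C (j + + (suc D ℕ.+ i))  ≡⟨ cong (λ d → C (j + d)) (ℤₚ.pos-+ (suc D) i) ⟩
            C (j + (+ suc D + + i))  ≡⟨ cong C (regroup j (+ suc D) (+ i)) ⟩
            C (j + + i + + suc D)    ≡⟨ sq i i<D ⟨
            C (j + + i)              ∎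

      open PeriodicColouring n C (λ {p} {q} n∣ → cong c (∣⇒π-≡ {p} {q} n∣)) C-adjacent C-distance-2 short-square-free

      halves-start-together : ∀ {x as x′ bs} → IsWalk (CycleAdj m) (x ∷ as ++ x′ ∷ bs) →
                              map c (x ∷ as) ≡ map c (x′ ∷ bs) → x ≡ x′
      halves-start-together {x} {as} {x′} {bs} walk colours with lift-walk (π-toℕ x) walk
      ... | ps , steps , πps with map-++⁻ π (+ toℕ x ∷ ps) {x ∷ as} {x′ ∷ bs} πps
      ... | []      , _       , _    , () , _
      ... | _ ∷ _   , []      , _    , _  , ()
      ... | a ∷ as′ , b ∷ bs′ , refl , πA , πB = begin
        x   ≡⟨ ∷-injectiveˡ πA ⟨
        π a ≡⟨ ∣⇒π-≡ {a} {b} (halves-congruent steps matched) ⟩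
        π b ≡⟨ ∷-injectiveˡ πB ⟩
        x′  ∎
        where
        matched : Pointwise _≈_ (a ∷ as′) (b ∷ bs′)
        matched = Pointwise.map⁻ C C (≡⇒Pointwise-≡ (begin
          map C (a ∷ as′)         ≡⟨ map-∘ (a ∷ as′) ⟩
          map c (map π (a ∷ as′)) ≡⟨ cong (map c) πA ⟩
          map c (x ∷ as)          ≡⟨ colours ⟩
          map c (x′ ∷ bs)         ≡⟨ cong (map c) πB ⟨
          map c (map π (b ∷ bs′)) ≡⟨ map-∘ (b ∷ bs′) ⟨
          map C (b ∷ bs′)         ∎))

      walk-nonrepetitive : WalkNonrepetitive (CycleAdj m) c
      walk-nonrepetitive w walk (y , ys , colours) with map-++⁻ c w {y ∷ ys} {y ∷ ys} colours
      ... | []     , _       , _    , () , _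
      ... | _ ∷ _  , []      , _    , _  , ()
      ... | x ∷ as , x′ ∷ bs , refl , cA , cB with halves-start-together walk (trans cA (sym cB))
      ... | refl = x , as , cong (λ zs → x ∷ as ++ x ∷ zs) (sym same-tail)
        where
        same-tail : as ≡ bs
        same-tail = colours-determine-walk CycleAdj-sym Finₚ._≟_ d2
          (proj₁ (Linked-++⁻ (x ∷ as) walk)) (proj₂ (Linked-++⁻ (x ∷ as) walk)) (∷-injectiveʳ (trans cA (sym cB)))

open import Data.Nat using (_+_)

lemma4 : (m k : ℕ) → (c : Fin (3 + m) → Fin k) →
    WalkNonrepetitive (CycleAdj m) c ⇔ (Distance2 (CycleAdj m) c × PathNonrepetitive (CycleAdj m) c)
lemma4 m k c = mk⇔
  (λ wn → walkNonrepetitive⇒distance2 (Cycle.CycleAdj-sym m) wn , walkNonrepetitive⇒pathNonrepetitive wn)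
  (λ (d2 , pn) → Cycle.walk-nonrepetitive m c d2 pn)
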